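{- Let $H$ be a fixed connected graph with $c>1$ vertices, let $G=(V,E)$ be a graph with maximum degree $\Delta$, and let $G'$ be the graph output by Construction 2 (described below). Then $G$ contains a subgraph $F=(V_F,E_F)$ isomorphic to $H$ if and only if $G'$ contains a subgraph $F'=(V_F',E_F')$ isomorphic to $H$, where $V_F'$ and $E_F'$ are copies in $G'$ of $V_F$ and $E_F$, respectively.
   Context: Construction 2: Compute an edge-coloring $\mathrm{col}\colon E\to\{1,\dots,f\}$ with $4c^2\le f<8c^2$ colors, surjective onto $\{1,\dots,f\}$, such that each vertex is incident to at most $\lceil\Delta/(4c^2)\rceil$ edges of the same color. If $\Delta\le 4c^2$, set $G'=G$. Otherwise, let $E^p$ be the set of edges of color $p$, and let $G'$ be the disjoint union, over all $c^2$-element sets $\{a_1,\dots,a_{c^2}\}\subseteq\{1,\dots,f\}$, of the graphs $(V,E^{a_1}\cup\dots\cup E^{a_{c^2}})$. Each vertex/edge of $G'$ is thus a copy of a vertex/edge of $G$. -}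

module Defs where

open import Data.Nat using (ℕ; zero; suc; _+_; _*_; _≤_; _<_; _≤?_; _⊔_)
open import Data.Nat.DivMod using (_/_)
open import Data.Bool using (Bool; true; false; if_then_else_)
open import Data.Fin using (Fin; _≟_)
open import Relation.Nullary.Decidable using (⌊_⌋)
open import Data.Fin.Subset using (Subset; _∈_; ∣_∣)
open import Data.Product using (Σ; _×_; _,_; proj₁; proj₂)
open import Relation.Binary.PropositionalEquality using (_≡_)
open import Relation.Nullary using (yes; no)
open import Function.Definitions using (Injective)

record SimpleGraph (n : ℕ) : Set where
  field
    adj   : Fin n → Fin n → Bool
    sym   : ∀ u v → adj u v ≡ adj v u
    irrefl : ∀ u → adj u u ≡ false
open SimpleGraph public

data Walk {n : ℕ} (G : SimpleGraph n) : Fin n → Fin n → Set where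
  []  : ∀ {u} → Walk G u u
  _∷_ : ∀ {u v w} → adj G u v ≡ true → Walk G v w → Walk G u w

Connected : ∀ {n} → SimpleGraph n → Set
Connected G = ∀ u v → Walk G u v

countFin : ∀ {n} → (Fin n → Bool) → ℕ
countFin {zero}  P = 0
countFin {suc n} P = (if P Fin.zero then 1 else 0) + countFin (λ i → P (Fin.suc i))

maxFin : ∀ {n} → (Fin n → ℕ) → ℕ
maxFin {zero}  g = 0
maxFin {suc n} g = g Fin.zero ⊔ maxFin (λ i → g (Fin.suc i))

degree : ∀ {n} → SimpleGraph n → Fin n → ℕ
degree G u = countFin (adj G u)

maxDegree : ∀ {n} → SimpleGraph n → ℕ
maxDegree G = maxFin (degree G)

-- ceiling division ⌈a / m⌉ (value at m = 0 irrelevant)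
ceilDiv : ℕ → ℕ → ℕ
ceilDiv a zero    = 0
ceilDiv a (suc m) = (a + m) / suc m

record Graph : Set₁ where
  field
    V : Set
    E : V → V → Set
open Graph public

toGraph : ∀ {n} → SimpleGraph n → Graph
toGraph {n} G = record { V = Fin n ; E = λ u v → adj G u v ≡ true }

-- injective homomorphism = embedding of A as a (not necessarily induced) subgraph of B
record InjHom (A B : Graph) : Set where
  field
    map  : V A → V B
    inj  : Injective _≡_ _≡_ map
    edge : ∀ {u v} → E A u v → E B (map u) (map v)
open InjHom public

-- An edge colouring col with colours Fin f (colours 1..f of the paper), given as a
-- function on pairs of vertices; only its values on edges matter.
record IsConstr2Colouring {n} (c : ℕ) (G : SimpleGraph n) (f : ℕ)
                          (col : Fin n → Fin n → Fin f) : Set where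
  field
    symm      : ∀ u v → adj G u v ≡ true → col u v ≡ col v u
    lower     : 4 * (c * c) ≤ f
    upper     : f < 8 * (c * c)
    surjective : ∀ p → Σ (Fin n) λ u → Σ (Fin n) λ v → (adj G u v ≡ true) × (col u v ≡ p)
    bounded   : ∀ u p → countFin (λ v → if adj G u v then ⌊ col u v ≟ p ⌋ else false)
                        ≤ ceilDiv (maxDegree G) (4 * (c * c))

-- output of Construction 2: the graph G' together with the map sending each copy
-- of a vertex of G to the vertex it is a copy of
record Output (n : ℕ) : Set₁ where
  field
    graph : Graph
    proj  : V graph → Fin n
open Output public

KSubset : ℕ → ℕ → Set
KSubset f k = Σ (Subset f) λ S → ∣ S ∣ ≡ k

-- disjoint union over c²-element colour sets S of (V, ⋃_{p ∈ S} E^p)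
blowUp : ∀ {n} (c : ℕ) (G : SimpleGraph n) (f : ℕ) (col : Fin n → Fin n → Fin f) → Output n
blowUp {n} c G f col = record
  { graph = record
      { V = KSubset f (c * c) × Fin n
      ; E = λ x y → (proj₁ (proj₁ x) ≡ proj₁ (proj₁ y))
                    × (adj G (proj₂ x) (proj₂ y) ≡ true)
                    × (col (proj₂ x) (proj₂ y) ∈ proj₁ (proj₁ x)) }
  ; proj = proj₂ }

construction2 : ∀ {n} (c : ℕ) (G : SimpleGraph n) (f : ℕ) (col : Fin n → Fin n → Fin f) → Output n
construction2 c G f col with maxDegree G ≤? 4 * (c * c)
... | yes _ = record { graph = toGraph G ; proj = λ v → v }
... | no  _ = blowUp c G f col

module Submission where

-- If Δ ≤ 4c² the construction returns G itself and there is nothing to prove.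
-- Otherwise G′ is the disjoint union, over all c²-element colour sets S, of the
-- layer (V, ⋃_{p ∈ S} E^p), and a vertex of G′ is a pair (S , v).
--
-- (⇒) A copy of H in G uses at most c² edge colours (one per ordered pair of
--     vertices of H).  Since f ≥ 4c² ≥ c², these colours fit into a c²-element
--     colour set S (`pairColourSet`, via `coveringSubset`, which combines the
--     finite-set facts `imageSubset` and `padSubset`), and the copy lies entirely
--     in layer S (`liftCopy`).
-- (⇐) Edges of G′ never leave a layer, so a copy of the connected graph H lies in
--     a single layer (`layerConstant`); inside one layer, forgetting S is injective
--     and maps edges to edges of G, so projecting gives a copy of H in G
--     (`projectCopy`).

open import Defs
open import Data.Nat using (ℕ; zero; suc; _*_; _≤_; _<_; s≤s; _≤?_)
open import Data.Nat.Properties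
  using (≤-refl; ≤-reflexive; ≤-trans; ≤-antisym; ≰⇒>; n≤1+n; m≤n*m; ≡-irrelevant)
open import Data.Fin using (Fin; combine; remQuot)
import Data.Fin as Fin
open import Data.Fin.Properties using (remQuot-combine)
open import Data.Fin.Subset using (Subset; inside; outside; _∈_; _⊆_; ∣_∣; ⊥)
open import Data.Fin.Subset.Properties using (∣p∣≤n; ∣⊥∣≡0)
open import Data.Vec.Base using ([]; _∷_; here; there)
open import Data.Bool using (true)
open import Data.Product using (Σ; _×_; _,_; proj₁; proj₂; uncurry)
open import Relation.Binary.PropositionalEquality
  using (_≡_; refl; cong; trans; subst)
open import Relation.Nullary using (yes; no)
open import Function using (_∘_)

insert : ∀ {f} → Fin f → Subset f → Subset f
insert Fin.zero    (_ ∷ S) = inside ∷ S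
insert (Fin.suc x) (b ∷ S) = b ∷ insert x S

insert-size : ∀ {f} (x : Fin f) (S : Subset f) → ∣ insert x S ∣ ≤ suc ∣ S ∣
insert-size Fin.zero    (inside  ∷ S) = n≤1+n _
insert-size Fin.zero    (outside ∷ S) = ≤-refl
insert-size (Fin.suc x) (inside  ∷ S) = s≤s (insert-size x S)
insert-size (Fin.suc x) (outside ∷ S) = insert-size x S

insert-∈ : ∀ {f} (x : Fin f) (S : Subset f) → x ∈ insert x S
insert-∈ Fin.zero    (_ ∷ S) = here
insert-∈ (Fin.suc x) (_ ∷ S) = there (insert-∈ x S)

insert-⊇ : ∀ {f} (x : Fin f) (S : Subset f) → S ⊆ insert x S
insert-⊇ Fin.zero    (_ ∷ S) here      = here
insert-⊇ Fin.zero    (_ ∷ S) (there p) = there p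
insert-⊇ (Fin.suc x) (_ ∷ S) here      = here
insert-⊇ (Fin.suc x) (_ ∷ S) (there p) = there (insert-⊇ x S p)

imageSubset : ∀ {m f} (g : Fin m → Fin f) →
              Σ (Subset f) λ S → (∣ S ∣ ≤ m) × (∀ i → g i ∈ S)
imageSubset {zero} {f} g = ⊥ , ≤-reflexive (∣⊥∣≡0 f) , λ ()
imageSubset {suc m} g with imageSubset (λ i → g (Fin.suc i))
... | S , size , covers =
  insert (g Fin.zero) S ,
  ≤-trans (insert-size (g Fin.zero) S) (s≤s size) ,
  λ { Fin.zero → insert-∈ (g Fin.zero) S
    ; (Fin.suc i) → insert-⊇ (g Fin.zero) S (covers i) }

padSubset : ∀ {f} (S : Subset f) (k : ℕ) → ∣ S ∣ ≤ k → k ≤ f →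
            Σ (Subset f) λ S′ → (∣ S′ ∣ ≡ k) × (S ⊆ S′)
padSubset [] zero _ _ = [] , refl , λ p → p
padSubset (inside ∷ S) (suc k) (s≤s le) (s≤s k≤f) with padSubset S k le k≤f
... | S′ , size , sub = inside ∷ S′ , cong suc size , λ { here → here ; (there p) → there (sub p) }
padSubset {suc f} (outside ∷ S) k le k≤1+f with k ≤? f
... | yes k≤f with padSubset S k le k≤f
...   | S′ , size , sub = outside ∷ S′ , size , λ { (there p) → there (sub p) }
-- k = f + 1: the whole remaining room must be used, including the first colour
padSubset {suc f} (outside ∷ S) k le k≤1+f | no k≰f with padSubset S f (∣p∣≤n S) ≤-refl
... | S′ , size , sub =
  inside ∷ S′ , trans (cong suc size) (≤-antisym (≰⇒> k≰f) k≤1+f) ,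
  λ { (there p) → there (sub p) }

coveringSubset : ∀ {m f} (g : Fin m → Fin f) → m ≤ f →
                 Σ (KSubset f m) λ S → ∀ i → g i ∈ proj₁ S
coveringSubset {m} g m≤f with imageSubset g
... | S , size , covers with padSubset S m size m≤f
...   | S′ , size′ , sub = (S′ , size′) , λ i → sub (covers i)

pairColourSet : ∀ {c f} (h : Fin c → Fin c → Fin f) → c * c ≤ f →
                Σ (KSubset f (c * c)) λ S → ∀ u v → h u v ∈ proj₁ S
pairColourSet {c} h cc≤f with coveringSubset (uncurry h ∘ remQuot c) cc≤f
... | S , covers = S , λ u v → subst (λ uv → uncurry h uv ∈ proj₁ S)
                                     (remQuot-combine u v) (covers (combine u v))

module BlowUp {n f : ℕ} (c : ℕ) (G : SimpleGraph n) (col : Fin n → Fin n → Fin f) where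

  G′ : Graph
  G′ = graph (blowUp c G f col)

  layer : V G′ → Subset f
  layer x = proj₁ (proj₁ x)

  -- Within a layer a vertex is determined by the vertex of G it copies
  -- (the size proof ∣ S ∣ ≡ c² carries no information).
  sameLayer-injective : (x y : V G′) → layer x ≡ layer y → proj₂ x ≡ proj₂ y → x ≡ y
  sameLayer-injective ((S , p) , v) ((.S , q) , .v) refl refl with ≡-irrelevant p q
  ... | refl = refl

  -- Edges of G′ stay inside a layer, so an edge-preserving map from a connected
  -- graph into G′ lands in a single layer.
  layerConstant : ∀ {k} (H : SimpleGraph k) → Connected H → (ψ : Fin k → V G′) →
                  (∀ {u v} → adj H u v ≡ true → E G′ (ψ u) (ψ v)) →
                  ∀ u v → layer (ψ u) ≡ layer (ψ v)
  layerConstant H connected ψ edge u v = alongWalk (connected u v)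
    where
    alongWalk : ∀ {u v} → Walk H u v → layer (ψ u) ≡ layer (ψ v)
    alongWalk []      = refl
    alongWalk (e ∷ w) = trans (proj₁ (edge e)) (alongWalk w)

  projectCopy : ∀ {k} (H : SimpleGraph k) → Connected H →
                (φ′ : InjHom (toGraph H) G′) →
                Σ (InjHom (toGraph H) (toGraph G)) λ φ → ∀ x → proj₂ (map φ′ x) ≡ map φ x
  projectCopy H connected φ′ =
    record { map = proj₂ ∘ map φ′ ; inj = injective ; edge = proj₁ ∘ proj₂ ∘ edge φ′ } ,
    λ x → refl
    where
    injective : ∀ {u v} → proj₂ (map φ′ u) ≡ proj₂ (map φ′ v) → u ≡ v
    injective {u} {v} same = inj φ′ (sameLayer-injective (map φ′ u) (map φ′ v)
                                       (layerConstant H connected (map φ′) (edge φ′) u v) same)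

  liftCopy : ∀ {k} (H : SimpleGraph k) (S : KSubset f (c * c))
             (φ : InjHom (toGraph H) (toGraph G)) →
             (∀ {u v} → adj H u v ≡ true → col (map φ u) (map φ v) ∈ proj₁ S) →
             Σ (InjHom (toGraph H) G′) λ φ′ → ∀ x → proj₂ (map φ′ x) ≡ map φ x
  liftCopy H S φ coloured =
    record { map = λ x → S , map φ x
           ; inj = λ same → inj φ (cong proj₂ same)
           ; edge = λ e → refl , edge φ e , coloured e } ,
    λ x → refl

lemma5 : (c : ℕ) → 1 < c → (H : SimpleGraph c) → Connected H →
         (n : ℕ) (G : SimpleGraph n) (f : ℕ) (col : Fin n → Fin n → Fin f) →
         IsConstr2Colouring c G f col →
         ((φ : InjHom (toGraph H) (toGraph G)) →
            Σ (InjHom (toGraph H) (graph (construction2 c G f col))) λ φ′ →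
              ∀ x → proj (construction2 c G f col) (map φ′ x) ≡ map φ x)
         ×
         ((φ′ : InjHom (toGraph H) (graph (construction2 c G f col))) →
            Σ (InjHom (toGraph H) (toGraph G)) λ φ →
              ∀ x → proj (construction2 c G f col) (map φ′ x) ≡ map φ x)
lemma5 c _ H connected n G f col isColouring with maxDegree G ≤? 4 * (c * c)
... | yes _ = (λ φ → φ , λ x → refl) , (λ φ′ → φ′ , λ x → refl)
... | no  _ = lift , projectCopy H connected
  where
  open BlowUp c G col

  c²≤f : c * c ≤ f
  c²≤f = ≤-trans (m≤n*m (c * c) 4) (IsConstr2Colouring.lower isColouring)

  lift : (φ : InjHom (toGraph H) (toGraph G)) →
         Σ (InjHom (toGraph H) G′) λ φ′ → ∀ x → proj₂ (map φ′ x) ≡ map φ x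
  lift φ with pairColourSet (λ u v → col (map φ u) (map φ v)) c²≤f
  ... | S , covers = liftCopy H S φ λ {u} {v} _ → covers u v
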